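{- Let $\begin{pmatrix} a&b\\c&d \end{pmatrix}\in\mathrm{SL}_2(\mathbb{Z})$, and let $a', b', c', d'\in \mathbb{Z}$ be such that $$ \begin{cases} a'\equiv a\pmod N, & c'\equiv c\pmod {MN}, \\ b'\equiv b\pmod {N}, & d'\equiv d\pmod{MN}, \end{cases} $$ with $0\leq a',b'< N$ and $0\leq c',d'< MN$. Then $$ \begin{pmatrix} a'&b'\\c'&d' \end{pmatrix}\in\mathcal{S}_{2,1}(C_N\times C_{MN}). $$
   Context: Let $N\geq 2$ and $M\geq 1$ be integers, and $C_k$ denote the cyclic group of order $k$. Identify the character group $(C_N\times C_{MN})^\vee$ with $\mathbb{Z}/N\times\mathbb{Z}/MN$. The set $\mathcal{S}_{2,1}(C_N\times C_{MN})$ is the finite set of matrices (symbols) $\begin{pmatrix} a_1&a_2\\ b_1&b_2\end{pmatrix}$ such that $(a_1,b_1),(a_2,b_2)\in (C_N\times C_{MN})^\vee$ (i.e. $a_i\in\mathbb{Z}/N$, $b_i\in\mathbb{Z}/MN$), $\mathbb{Z}(a_1,b_1)+\mathbb{Z}(a_2,b_2)=(C_N\times C_{MN})^\vee$, and $a_1b_2-a_2b_1\equiv 1\pmod N$. -}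

module Defs where

open import Data.Nat using (ℕ)
open import Data.Integer using (ℤ; +_; _+_; _-_; _*_)
open import Data.Integer.Divisibility using (_∣_)
open import Data.Product using (_×_; ∃₂)
open import Relation.Binary.PropositionalEquality using (_≡_)

infix 4 _≡_[mod_]

_≡_[mod_] : ℤ → ℤ → ℕ → Set
x ≡ y [mod n ] = (+ n) ∣ (x - y)

InSL₂ℤ : ℤ → ℤ → ℤ → ℤ → Set
InSL₂ℤ a b c d = a * d - b * c ≡ + 1

-- The character group (C_N × C_{MN})^∨ is identified with ℤ/N × ℤ/MN;
-- an element is represented by a pair of integers (α , β), read modulo N
-- and modulo MN respectively.
Generates : ℕ → ℕ → ℤ → ℤ → ℤ → ℤ → Set
Generates N M a₁ b₁ a₂ b₂ =
  ∀ (x y : ℤ) → ∃₂ λ (m n : ℤ) →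
    (x ≡ m * a₁ + n * a₂ [mod N ]) × (y ≡ m * b₁ + n * b₂ [mod (M Data.Nat.* N) ])

-- The symbol (a₁ a₂ ; b₁ b₂) lies in 𝒮_{2,1}(C_N × C_{MN}).
-- Entries a₁,a₂ ∈ ℤ/N and b₁,b₂ ∈ ℤ/MN are given by integer representatives.
InS21 : ℕ → ℕ → ℤ → ℤ → ℤ → ℤ → Set
InS21 N M a₁ a₂ b₁ b₂ =
  Generates N M a₁ b₁ a₂ b₂ × (a₁ * b₂ - a₂ * b₁ ≡ + 1 [mod N ])

{-# OPTIONS --safe #-}
-- By Cramer's rule the columns (a , c) and (b , d) of a matrix in SL₂(ℤ) span ℤ² with
-- the integer coefficients (d x - b y , - c x + a y), so they span ℤ/N × ℤ/MN too, and
-- the determinant is 1.  Both conditions defining 𝒮_{2,1} only see the top row modulo N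
-- and the bottom row modulo MN (hence modulo N), so they survive replacing the entries
-- by the congruent a', b', c', d'.
module Submission where

open import Defs
open import Data.Nat using (ℕ; _≤_)
import Data.Nat as ℕ
open import Data.Integer using (ℤ; +_; _+_; _-_; _*_; -_) renaming (_≤_ to _≤ℤ_; _<_ to _<ℤ_)
open import Data.Integer.Properties using (+-inverseʳ; *-identityʳ)
open import Data.Integer.Tactic.RingSolver using (solve-∀)
open import Data.Product using (_×_; _,_)
open import Relation.Binary.PropositionalEquality using (_≡_; refl; sym; cong; module ≡-Reasoning)
import Data.Integer.Divisibility.Signed as Signed
import Data.Nat.Divisibility as ℕ

infix 4 _≈_[mod_]

-- `x ≡ y [mod n ]` unfolds to a divisibility between absolute values, from which
-- Agda cannot recover x and y; this record keeps them as indices.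
record _≈_[mod_] (x y : ℤ) (n : ℕ) : Set where
  constructor ≈-mod
  field difference : + n Signed.∣ x - y

open _≈_[mod_]

private variable
  n : ℕ
  x y z u v a b c d a' b' c' d' : ℤ

≡-mod⇒≈ : ∀ x y → x ≡ y [mod n ] → x ≈ y [mod n ]
≡-mod⇒≈ _ _ x≡y = ≈-mod (Signed.∣ᵤ⇒∣ x≡y)

≈⇒≡-mod : x ≈ y [mod n ] → x ≡ y [mod n ]
≈⇒≡-mod x≈y = Signed.∣⇒∣ᵤ (difference x≈y)

≈-via-difference : ∀ {e} → x - y ≡ e → + n Signed.∣ e → x ≈ y [mod n ]
≈-via-difference refl = ≈-mod

≈-refl : x ≈ x [mod n ]
≈-refl {x} = ≈-via-difference (+-inverseʳ x) (Signed.divides (+ 0) refl)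

≡⇒≈ : x ≡ y → x ≈ y [mod n ]
≡⇒≈ refl = ≈-refl

≈-sym : x ≈ y [mod n ] → y ≈ x [mod n ]
≈-sym {x} {y} x≈y = ≈-via-difference (split x y) (Signed.∣m⇒∣-m (difference x≈y))
  where
  split : ∀ x y → y - x ≡ - (x - y)
  split = solve-∀

≈-trans : x ≈ y [mod n ] → y ≈ z [mod n ] → x ≈ z [mod n ]
≈-trans {x} {y} {z = z} x≈y y≈z =
  ≈-via-difference (split x y z) (Signed.∣m∣n⇒∣m+n (difference x≈y) (difference y≈z))
  where
  split : ∀ x y z → x - z ≡ (x - y) + (y - z)
  split = solve-∀

+-cong-mod : x ≈ y [mod n ] → u ≈ v [mod n ] → x + u ≈ y + v [mod n ]
+-cong-mod {x} {y} {u = u} {v} x≈y u≈v =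
  ≈-via-difference (split x y u v) (Signed.∣m∣n⇒∣m+n (difference x≈y) (difference u≈v))
  where
  split : ∀ x y u v → (x + u) - (y + v) ≡ (x - y) + (u - v)
  split = solve-∀

-‿cong-mod : x ≈ y [mod n ] → - x ≈ - y [mod n ]
-‿cong-mod {x} {y} x≈y = ≈-via-difference (split x y) (Signed.∣m⇒∣-m (difference x≈y))
  where
  split : ∀ x y → - x - - y ≡ - (x - y)
  split = solve-∀

*-cong-mod : x ≈ y [mod n ] → u ≈ v [mod n ] → x * u ≈ y * v [mod n ]
*-cong-mod {x} {y} {u = u} {v} x≈y u≈v =
  ≈-via-difference (split x y u v)
    (Signed.∣m∣n⇒∣m+n (Signed.∣n⇒∣m*n x (difference u≈v)) (Signed.∣m⇒∣m*n v (difference x≈y)))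
  where
  split : ∀ x y u v → x * u - y * v ≡ x * (u - v) + (x - y) * v
  split = solve-∀

≈-mod-∣ : ∀ {m} → m ℕ.∣ n → x ≈ y [mod n ] → x ≈ y [mod m ]
≈-mod-∣ {n} {m = m} m∣n x≈y = ≈-mod (Signed.∣-trans (Signed.∣ᵤ⇒∣ {+ m} {+ n} m∣n) (difference x≈y))


lincomb-cong-mod : ∀ p q → u ≈ a [mod n ] → v ≈ b [mod n ] → p * u + q * v ≈ p * a + q * b [mod n ]
lincomb-cong-mod p q u≈a v≈b = +-cong-mod (*-cong-mod (≈-refl {p}) u≈a) (*-cong-mod (≈-refl {q}) v≈b)

det-cong-mod : a' ≈ a [mod n ] → b' ≈ b [mod n ] → c' ≈ c [mod n ] → d' ≈ d [mod n ] →
               a' * d' - b' * c' ≈ a * d - b * c [mod n ]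
det-cong-mod a'≈a b'≈b c'≈c d'≈d = +-cong-mod (*-cong-mod a'≈a d'≈d) (-‿cong-mod (*-cong-mod b'≈b c'≈c))

cramer : InSL₂ℤ a b c d → ∀ x y →
         ((d * x - b * y) * a + (- c * x + a * y) * b ≡ x) ×
         ((d * x - b * y) * c + (- c * x + a * y) * d ≡ y)
cramer {a} {b} {c} {d} det x y = scale x (first a b c d x y) , scale y (second a b c d x y)
  where
  open ≡-Reasoning
  scale : ∀ z {w} → w ≡ z * (a * d - b * c) → w ≡ z
  scale z {w} w≡z*det = begin
    w                   ≡⟨ w≡z*det ⟩
    z * (a * d - b * c) ≡⟨ cong (z *_) det ⟩
    z * + 1             ≡⟨ *-identityʳ z ⟩
    z                   ∎
  first : ∀ a b c d x y → (d * x - b * y) * a + (- c * x + a * y) * b ≡ x * (a * d - b * c)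
  first = solve-∀
  second : ∀ a b c d x y → (d * x - b * y) * c + (- c * x + a * y) * d ≡ y * (a * d - b * c)
  second = solve-∀

SL₂ℤ⇒InS21 : ∀ N M → InSL₂ℤ a b c d → InS21 N M a b c d
SL₂ℤ⇒InS21 {a} {b} {c} {d} N M det = generates , ≈⇒≡-mod (≡⇒≈ det)
  where
  generates : Generates N M a c b d
  generates x y =
    let first , second = cramer {a} {b} {c} {d} det x y in
    d * x - b * y , - c * x + a * y , ≈⇒≡-mod (≡⇒≈ (sym first)) , ≈⇒≡-mod (≡⇒≈ (sym second))

Generates-cong : ∀ {N} M → a' ≈ a [mod N ] → c' ≈ c [mod M ℕ.* N ] →
                 b' ≈ b [mod N ] → d' ≈ d [mod M ℕ.* N ] →
                 Generates N M a c b d → Generates N M a' c' b' d'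
Generates-cong M a'≈a c'≈c b'≈b d'≈d generates x y =
  let p , q , x≡pa+qb , y≡pc+qd = generates x y in
  p , q , ≈⇒≡-mod (≈-trans (≡-mod⇒≈ x _ x≡pa+qb) (lincomb-cong-mod p q (≈-sym a'≈a) (≈-sym b'≈b)))
        , ≈⇒≡-mod (≈-trans (≡-mod⇒≈ y _ y≡pc+qd) (lincomb-cong-mod p q (≈-sym c'≈c) (≈-sym d'≈d)))

InS21-cong : ∀ {N} M → a' ≡ a [mod N ] → b' ≡ b [mod N ] →
             c' ≡ c [mod M ℕ.* N ] → d' ≡ d [mod M ℕ.* N ] →
             InS21 N M a b c d → InS21 N M a' b' c' d'
InS21-cong {a'} {a} {b'} {b} {c'} {c} {d'} {d} {N} M a'≡a b'≡b c'≡c d'≡d (generates , det≡1) =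
  Generates-cong M a'≈a c'≈c b'≈b d'≈d generates , ≈⇒≡-mod det′≈1
  where
  a'≈a : a' ≈ a [mod N ]
  a'≈a = ≡-mod⇒≈ a' a a'≡a
  b'≈b : b' ≈ b [mod N ]
  b'≈b = ≡-mod⇒≈ b' b b'≡b
  c'≈c : c' ≈ c [mod M ℕ.* N ]
  c'≈c = ≡-mod⇒≈ c' c c'≡c
  d'≈d : d' ≈ d [mod M ℕ.* N ]
  d'≈d = ≡-mod⇒≈ d' d d'≡d
  det′≈1 : a' * d' - b' * c' ≈ + 1 [mod N ]
  det′≈1 = ≈-trans (det-cong-mod a'≈a b'≈b (≈-mod-∣ (ℕ.n∣m*n M) c'≈c) (≈-mod-∣ (ℕ.n∣m*n M) d'≈d))
                   (≡-mod⇒≈ _ _ det≡1)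

lemma3p3 : (N M : ℕ) → 2 ≤ N → 1 ≤ M →
    (a b c d : ℤ) → InSL₂ℤ a b c d →
    (a' b' c' d' : ℤ) →
    a' ≡ a [mod N ] → b' ≡ b [mod N ] →
    c' ≡ c [mod (M Data.Nat.* N) ] → d' ≡ d [mod (M Data.Nat.* N) ] →
    (+ 0 ≤ℤ a') × (a' <ℤ + N) → (+ 0 ≤ℤ b') × (b' <ℤ + N) →
    (+ 0 ≤ℤ c') × (c' <ℤ + (M Data.Nat.* N)) → (+ 0 ≤ℤ d') × (d' <ℤ + (M Data.Nat.* N)) →
    InS21 N M a' b' c' d'
lemma3p3 N M _ _ a b c d det a' b' c' d' a'≡a b'≡b c'≡c d'≡d _ _ _ _ =
  InS21-cong M a'≡a b'≡b c'≡c d'≡d (SL₂ℤ⇒InS21 N M det)
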